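{- Let $k\in\{2,3,6\}$, let $a$ be a positive integer with $ka^2+4=r^2$ for a positive integer $r$, put $b=ka$, assume $b>10^5$, and let $c=c_3^{\pm}=(a^2b^2+6ab+9)(a+b\pm 2r)\mp 4r(ab+3)$. Let $s,t$ be the positive integers with $ac+4=s^2$, $bc+4=t^2$. For integers $z_0,x_0,z_1,y_1$ define sequences $$v_0=z_0,\ v_1=\tfrac12(sz_0+cx_0),\ v_{m+2}=sv_{m+1}-v_m,\qquad w_0=z_1,\ w_1=\tfrac12(tz_1+cy_1),\ w_{n+2}=tw_{n+1}-w_n .$$ Consider solutions $(m,n)$ with $2<n<m<2n$. (i) If $z_0=z_1\in\{2,-2\}$, $x_0=y_1=2$, and $v_{2m}=w_{2n}$ with $n>1$, then $m>0.495\,b^{ -0.5}c^{0.5}$. (ii) If $z_0\in\{t,-t\}$, $z_1\in\{s,-s\}$, $z_0z_1>0$, $x_0=y_1=r$, and $v_{2m+1}=w_{2n+1}$ with $n>1$, then $m^2>0.0625\,b^{ -1}c^{0.5}$.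
   Context: These sequences arise from extending the $D(4)$-triple $\{a,b,c\}$ to a $D(4)$-quadruple $\{a,b,c,d\}$ with $ad+4=x^2$, $bd+4=y^2$, $cd+4=z^2$; the common values $z=v_m=w_n$ correspond to such extensions. A $D(4)$-triple/quadruple is a set of distinct positive integers such that the product of any two distinct elements increased by $4$ is a perfect square. -}

module Defs where

open import Data.Nat using (ℕ; zero; suc)
open import Data.Integer as ℤ using (ℤ)
open import Data.Rational as ℚ using (ℚ; ½)

⟦_⟧ : ℤ → ℚ
⟦ x ⟧ = x ℚ./ 1

rec : ℚ → ℚ → ℚ → ℕ → ℚ
rec p q₀ q₁ zero = q₀
rec p q₀ q₁ (suc zero) = q₁
rec p q₀ q₁ (suc (suc m)) = p ℚ.* rec p q₀ q₁ (suc m) ℚ.- rec p q₀ q₁ m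

vseq : (s c z₀ x₀ : ℤ) → ℕ → ℚ
vseq s c z₀ x₀ = rec ⟦ s ⟧ ⟦ z₀ ⟧ (½ ℚ.* ⟦ s ℤ.* z₀ ℤ.+ c ℤ.* x₀ ⟧)

wseq : (t c z₁ y₁ : ℤ) → ℕ → ℚ
wseq t c z₁ y₁ = rec ⟦ t ⟧ ⟦ z₁ ⟧ (½ ℚ.* ⟦ t ℤ.* z₁ ℤ.+ c ℤ.* y₁ ⟧)

c3plus : (a b r : ℤ) → ℤ
c3plus a b r = (a ℤ.* a ℤ.* b ℤ.* b ℤ.+ ℤ.+ 6 ℤ.* a ℤ.* b ℤ.+ ℤ.+ 9) ℤ.* (a ℤ.+ b ℤ.+ ℤ.+ 2 ℤ.* r)
               ℤ.- ℤ.+ 4 ℤ.* r ℤ.* (a ℤ.* b ℤ.+ ℤ.+ 3)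

c3minus : (a b r : ℤ) → ℤ
c3minus a b r = (a ℤ.* a ℤ.* b ℤ.* b ℤ.+ ℤ.+ 6 ℤ.* a ℤ.* b ℤ.+ ℤ.+ 9) ℤ.* (a ℤ.+ b ℤ.- ℤ.+ 2 ℤ.* r)
                ℤ.+ ℤ.+ 4 ℤ.* r ℤ.* (a ℤ.* b ℤ.+ ℤ.+ 3)

-- Both bounds are proved by contradiction: assume m is small.
--
-- Put U = 2v, an integer sequence.  Bisecting the recurrence, m ↦ U_{2m+i} is again a Lucas
-- sequence, with multiplier s² − 2 = 2 + ac ≡ 2 (mod c); modulo c² it is therefore quadratic
-- in m, and an equation v_{2m+i} = w_{2n+i} becomes a congruence modulo c.
--
-- (i)  Here v is integral and the congruence reads ±(am² − bn²) ≡ tn − sm (mod c).  Rearranged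
-- so that both sides are natural numbers, both are below c when m is small, so it is an equation;
-- with (sm)² = c·am² + 4m² and (tn)² = c·bn² + 4n² it gives (c ± (sm + tn))(bn² − am²) = 4(m² − n²),
-- hence c − 2tm ≤ 4m², which is false for small m.
--
-- (ii) Here s z₀ = t z₁ = g and the congruence reads gX + 2r(m − n) ≡ 0 with
-- X = a·T(m+1) − b·T(n+1), T(j) = j(j − 1)/2.  As g² = (ac + 4)(bc + 4) ≡ 16, squaring gives
-- 16X² ≡ 4r²(m − n)² (mod c), again an equation for small m.  With X = aY and r² = ka² + 4 it
-- says a²(4Y² − k(m − n)²) = 4(m − n)², so a² ≤ 4m² and c ≥ 256m⁴b² ≥ 16a⁴b²; but every
-- c = c₃^± satisfies c ≤ (ab + 3)²(a + b + 2r) < 16a⁴b².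
--
-- Among the conditions on (m, n) only n < m is used.

module Submission where

open import Defs
open import Data.Nat as ℕ using (ℕ)
import Data.Nat.Properties as ℕ
open import Data.Integer as ℤ using (ℤ; +_; -_)
import Data.Integer.Properties as ℤ
open import Data.Product using (_×_; ∃-syntax; _,_)
open import Data.Sum using (_⊎_; inj₁; inj₂)
open import Relation.Binary.PropositionalEquality using (_≡_; refl; sym; trans; cong; subst; module ≡-Reasoning)

module Lucas where

  open import Data.Nat.Base as ℕ using (ℕ; zero; suc)
  import Data.Nat.Properties as ℕ
  open import Data.Integer.Base hiding (suc)
  open import Data.Integer.Tactic.RingSolver using (solve-∀)
  open import Data.Product.Base using (∃-syntax; _×_; _,_; proj₁)
  open import Relation.Binary.PropositionalEquality

  lucas : ℤ → ℤ → ℤ → ℕ → ℤ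
  lucas p x y zero = x
  lucas p x y (suc zero) = y
  lucas p x y (suc (suc n)) = p * lucas p x y (suc n) - lucas p x y n

  lucas-unique : ∀ p (f : ℕ → ℤ) → (∀ n → f (2 ℕ.+ n) ≡ p * f (suc n) - f n) →
                 ∀ n → f n ≡ lucas p (f 0) (f 1) n
  lucas-unique p f step zero = refl
  lucas-unique p f step (suc zero) = refl
  lucas-unique p f step (suc (suc n)) = trans (step n)
    (cong₂ (λ u v → p * u - v) (lucas-unique p f step (suc n)) (lucas-unique p f step n))

  lucas-*ˡ : ∀ p k x y n → lucas p (k * x) (k * y) n ≡ k * lucas p x y n
  lucas-*ˡ p k x y n = sym (lucas-unique p (λ n → k * lucas p x y n) step n)
    where
    distrib : ∀ p k u v → k * (p * u - v) ≡ p * (k * u) - k * v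
    distrib = solve-∀
    step : ∀ n → k * lucas p x y (2 ℕ.+ n) ≡ p * (k * lucas p x y (suc n)) - k * lucas p x y n
    step n = distrib p k (lucas p x y (suc n)) (lucas p x y n)

  lucas-bisect : ∀ p x y i j →
    lucas p x y (2 ℕ.* j ℕ.+ i) ≡ lucas (p * p - + 2) (lucas p x y i) (lucas p x y (2 ℕ.+ i)) j
  lucas-bisect p x y i = lucas-unique (p * p - + 2) (λ j → lucas p x y (2 ℕ.* j ℕ.+ i)) step
    where
    shift : ∀ j → 2 ℕ.* suc j ℕ.+ i ≡ 2 ℕ.+ (2 ℕ.* j ℕ.+ i)
    shift j = trans (cong (ℕ._+ i) (ℕ.*-suc 2 j)) (ℕ.+-assoc 2 (2 ℕ.* j) i)
    double-step : ∀ p u v → p * (p * (p * u - v) - u) - (p * u - v) ≡ (p * p - + 2) * (p * u - v) - v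
    double-step = solve-∀
    step : ∀ j → lucas p x y (2 ℕ.* (2 ℕ.+ j) ℕ.+ i)
               ≡ (p * p - + 2) * lucas p x y (2 ℕ.* suc j ℕ.+ i) - lucas p x y (2 ℕ.* j ℕ.+ i)
    step j = begin
      lucas p x y (2 ℕ.* (2 ℕ.+ j) ℕ.+ i)
        ≡⟨ cong (lucas p x y) (trans (shift (suc j)) (cong (2 ℕ.+_) (shift j))) ⟩
      lucas p x y (4 ℕ.+ k)
        ≡⟨ double-step p (lucas p x y (suc k)) (lucas p x y k) ⟩
      (p * p - + 2) * lucas p x y (2 ℕ.+ k) - lucas p x y k
        ≡⟨ cong (λ l → (p * p - + 2) * lucas p x y l - lucas p x y k) (shift j) ⟨
      (p * p - + 2) * lucas p x y (2 ℕ.* suc j ℕ.+ i) - lucas p x y k ∎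
      where
      open ≡-Reasoning
      k = 2 ℕ.* j ℕ.+ i

  triangular : ℕ → ℕ
  triangular zero = 0
  triangular (suc n) = triangular n ℕ.+ n

  -- The second differences of the sequence are ac times its terms, all ≡ A (mod c).
  lucas-mod-c² : ∀ a c A B n → ∃[ Q ]
    lucas (+ 2 + a * c) A (A + c * B) n ≡ A + c * (+ n * B + a * A * + triangular n) + c * c * Q
  lucas-mod-c² a c A B n = proj₁ (consecutive n)
    where
    Expansion : ℕ → Set
    Expansion n = ∃[ Q ]
      lucas (+ 2 + a * c) A (A + c * B) n ≡ A + c * (+ n * B + a * A * + triangular n) + c * c * Q
    base₀ : ∀ a c A B → A ≡ A + c * (+ 0 * B + a * A * + 0) + c * c * + 0
    base₀ = solve-∀
    base₁ : ∀ a c A B → A + c * B ≡ A + c * (+ 1 * B + a * A * + 0) + c * c * + 0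
    base₁ = solve-∀
    step : ∀ a c A B N T Q₀ Q₁ →
      (+ 2 + a * c) * (A + c * ((+ 1 + N) * B + a * A * (T + N)) + c * c * Q₁)
        - (A + c * (N * B + a * A * T) + c * c * Q₀)
      ≡ A + c * ((+ 2 + N) * B + a * A * (T + N + (+ 1 + N)))
          + c * c * ((+ 2 + a * c) * Q₁ - Q₀ + a * ((+ 1 + N) * B + a * A * (T + N)))
    step = solve-∀
    consecutive : ∀ n → Expansion n × Expansion (suc n)
    consecutive zero = (+ 0 , base₀ a c A B) , (+ 0 , base₁ a c A B)
    consecutive (suc n) =
      let (Q₀ , eq₀) , (Q₁ , eq₁) = consecutive n
      in (Q₁ , eq₁) , (_ , trans (cong₂ (λ u v → (+ 2 + a * c) * u - v) eq₁ eq₀)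
                                 (step a c A B (+ n) (+ triangular n) Q₀ Q₁))

module Rationals where

  open import Data.Nat.Base using (suc)
  open import Data.Integer.Base as ℤ using (ℤ; +_; -[1+_]; +[1+_])
  open import Data.Rational.Base as ℚ using (ℚ; mkℚ; ↥_; ½; _+_; _*_; _-_)
  import Data.Rational.Properties as ℚ
  open import Data.Rational.Solver using (module +-*-Solver)
  open import Data.Nat.Coprimality using (1-coprimeTo)
  import Data.Nat.Coprimality as Coprime
  open import Data.Integer.Tactic.RingSolver using (solve-∀)
  open import Relation.Binary.PropositionalEquality
  open Lucas using (lucas)

  whole : ℤ → ℚ
  whole x = mkℚ x 0 (Coprime.sym (1-coprimeTo ℤ.∣ x ∣))

  ⟦⟧≡whole : ∀ x → ⟦ x ⟧ ≡ whole x
  ⟦⟧≡whole x = ℚ.↥p/↧p≡p (whole x)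

  ⟦⟧-injective : ∀ {x y} → ⟦ x ⟧ ≡ ⟦ y ⟧ → x ≡ y
  ⟦⟧-injective {x} {y} eq = cong ↥_ (trans (sym (⟦⟧≡whole x)) (trans eq (⟦⟧≡whole y)))

  ⟦⟧-* : ∀ x y → ⟦ x ℤ.* y ⟧ ≡ ⟦ x ⟧ * ⟦ y ⟧
  ⟦⟧-* x y = sym (cong₂ _*_ (⟦⟧≡whole x) (⟦⟧≡whole y))

  ⟦⟧-+ : ∀ x y → ⟦ x ℤ.+ y ⟧ ≡ ⟦ x ⟧ + ⟦ y ⟧
  ⟦⟧-+ x y = trans (cong ⟦_⟧ (times-one x y)) (sym (cong₂ _+_ (⟦⟧≡whole x) (⟦⟧≡whole y)))
    where
    times-one : ∀ x y → x ℤ.+ y ≡ x ℤ.* + 1 ℤ.+ y ℤ.* + 1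
    times-one = solve-∀

  ⟦⟧-neg : ∀ x → ⟦ - x ⟧ ≡ ℚ.- ⟦ x ⟧
  ⟦⟧-neg x = trans (⟦⟧≡whole (- x)) (trans (neg-whole x) (cong ℚ.-_ (sym (⟦⟧≡whole x))))
    where
    neg-whole : ∀ x → whole (- x) ≡ ℚ.- whole x
    neg-whole (+ 0) = refl
    neg-whole +[1+ n ] = refl
    neg-whole -[1+ n ] = refl

  ⟦⟧-recurrence : ∀ p u v → ⟦ p ℤ.* u ℤ.- v ⟧ ≡ ⟦ p ⟧ * ⟦ u ⟧ - ⟦ v ⟧
  ⟦⟧-recurrence p u v = trans (⟦⟧-+ (p ℤ.* u) (ℤ.- v)) (cong₂ _+_ (⟦⟧-* p u) (⟦⟧-neg v))

  ½⟦2*⟧ : ∀ x → ½ * ⟦ + 2 ℤ.* x ⟧ ≡ ⟦ x ⟧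
  ½⟦2*⟧ x = trans (cong (½ *_) (⟦⟧-* (+ 2) x))
                  (trans (sym (ℚ.*-assoc ½ ⟦ + 2 ⟧ ⟦ x ⟧)) (ℚ.*-identityˡ ⟦ x ⟧))

  ½⟦⟧-injective : ∀ {x y} → ½ * ⟦ x ⟧ ≡ ½ * ⟦ y ⟧ → x ≡ y
  ½⟦⟧-injective {x} {y} eq = ⟦⟧-injective (begin
    ⟦ x ⟧                  ≡⟨ 2*½ x ⟨
    ⟦ + 2 ⟧ * (½ * ⟦ x ⟧)  ≡⟨ cong (⟦ + 2 ⟧ *_) eq ⟩
    ⟦ + 2 ⟧ * (½ * ⟦ y ⟧)  ≡⟨ 2*½ y ⟩
    ⟦ y ⟧                  ∎)
    where
    open ≡-Reasoning
    2*½ : ∀ x → ⟦ + 2 ⟧ * (½ * ⟦ x ⟧) ≡ ⟦ x ⟧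
    2*½ x = trans (sym (ℚ.*-assoc ⟦ + 2 ⟧ ½ ⟦ x ⟧)) (ℚ.*-identityˡ ⟦ x ⟧)

  rec-½⟦⟧ : ∀ p x y n → rec ⟦ p ⟧ (½ * ⟦ x ⟧) (½ * ⟦ y ⟧) n ≡ ½ * ⟦ lucas p x y n ⟧
  rec-½⟦⟧ p x y 0 = refl
  rec-½⟦⟧ p x y 1 = refl
  rec-½⟦⟧ p x y (suc (suc n)) = begin
    ⟦ p ⟧ * rec′ (suc n) - rec′ n
      ≡⟨ cong₂ (λ u v → ⟦ p ⟧ * u - v) (rec-½⟦⟧ p x y (suc n)) (rec-½⟦⟧ p x y n) ⟩
    ⟦ p ⟧ * (½ * ⟦ lucas p x y (suc n) ⟧) - ½ * ⟦ lucas p x y n ⟧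
      ≡⟨ factor-½ ⟦ p ⟧ ½ ⟦ lucas p x y (suc n) ⟧ ⟦ lucas p x y n ⟧ ⟩
    ½ * (⟦ p ⟧ * ⟦ lucas p x y (suc n) ⟧ - ⟦ lucas p x y n ⟧)
      ≡⟨ cong (½ *_) (⟦⟧-recurrence p (lucas p x y (suc n)) (lucas p x y n)) ⟨
    ½ * ⟦ lucas p x y (suc (suc n)) ⟧ ∎
    where
    open ≡-Reasoning
    rec′ = rec ⟦ p ⟧ (½ * ⟦ x ⟧) (½ * ⟦ y ⟧)
    factor-½ : ∀ P H U V → P * (H * U) - H * V ≡ H * (P * U - V)
    factor-½ = +-*-Solver.solve 4 (λ P H U V → P :* (H :* U) :- H :* V := H :* (P :* U :- V)) refl
      where open +-*-Solver

  vseq≡½⟦lucas⟧ : ∀ s c z x n → vseq s c z x n ≡ ½ * ⟦ lucas s (+ 2 ℤ.* z) (s ℤ.* z ℤ.+ c ℤ.* x) n ⟧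
  vseq≡½⟦lucas⟧ s c z x n = trans
    (cong (λ q → rec ⟦ s ⟧ q (½ * ⟦ s ℤ.* z ℤ.+ c ℤ.* x ⟧) n) (sym (½⟦2*⟧ z)))
    (rec-½⟦⟧ s (+ 2 ℤ.* z) (s ℤ.* z ℤ.+ c ℤ.* x) n)

  vseq≡wseq⇒lucas≡lucas : ∀ s t c z₀ z₁ x₀ y₁ i j → vseq s c z₀ x₀ i ≡ wseq t c z₁ y₁ j →
    lucas s (+ 2 ℤ.* z₀) (s ℤ.* z₀ ℤ.+ c ℤ.* x₀) i ≡ lucas t (+ 2 ℤ.* z₁) (t ℤ.* z₁ ℤ.+ c ℤ.* y₁) j
  vseq≡wseq⇒lucas≡lucas s t c z₀ z₁ x₀ y₁ i j eq =
    ½⟦⟧-injective (trans (sym (vseq≡½⟦lucas⟧ s c z₀ x₀ i)) (trans eq (vseq≡½⟦lucas⟧ t c z₁ y₁ j)))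

module Congruences where

  open import Data.Nat.Base as ℕ using (suc)
  import Data.Nat.Properties as ℕ
  open import Data.Integer.Base hiding (suc)
  import Data.Integer.Properties as ℤ
  open import Data.Integer.Tactic.RingSolver using (solve-∀; solve)
  open import Data.List.Base using (_∷_; [])
  open import Data.Product.Base using (∃-syntax; _,_)
  open import Relation.Binary.PropositionalEquality
  open ≡-Reasoning
  open Lucas

  triangular-square : ∀ m → + 2 * + triangular m + + m ≡ + m * + m
  triangular-square ℕ.zero = refl
  triangular-square (suc m) = begin
    + 2 * (+ triangular m + + m) + (+ 1 + + m)     ≡⟨ split (+ triangular m) (+ m) ⟩
    (+ 2 * + triangular m + + m) + (+ 2 * + m + + 1) ≡⟨ cong (_+ (+ 2 * + m + + 1)) (triangular-square m) ⟩
    + m * + m + (+ 2 * + m + + 1)                  ≡⟨ complete (+ m) ⟩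
    (+ 1 + + m) * (+ 1 + + m)                      ∎
    where
    split : ∀ T M → + 2 * (T + M) + (+ 1 + M) ≡ (+ 2 * T + M) + (+ 2 * M + + 1)
    split = solve-∀
    complete : ∀ M → M * M + (+ 2 * M + + 1) ≡ (+ 1 + M) * (+ 1 + M)
    complete = solve-∀

  bisected-multiplier : ∀ a c s → s * s ≡ a * c + + 4 → s * s - + 2 ≡ + 2 + a * c
  bisected-multiplier a c s hs = begin
    s * s - + 2         ≡⟨ cong (_- + 2) hs ⟩
    a * c + + 4 - + 2   ≡⟨ solve (a ∷ c ∷ []) ⟩
    + 2 + a * c         ∎

  mod-c²⇒mod-c : ∀ A c x y Q₁ Q₂ .{{_ : NonZero c}} →
    A + c * x + c * c * Q₁ ≡ A + c * y + c * c * Q₂ → x - y ≡ c * (Q₂ - Q₁)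
  mod-c²⇒mod-c A c x y Q₁ Q₂ eq = ℤ.*-cancelˡ-≡ c (x - y) (c * (Q₂ - Q₁)) (begin
    c * (x - y)
      ≡⟨ solve (A ∷ c ∷ x ∷ y ∷ Q₁ ∷ Q₂ ∷ []) ⟩
    (A + c * x + c * c * Q₁) - (A + c * y + c * c * Q₂) + c * (c * (Q₂ - Q₁))
      ≡⟨ cong (λ u → u - (A + c * y + c * c * Q₂) + c * (c * (Q₂ - Q₁))) eq ⟩
    (A + c * y + c * c * Q₂) - (A + c * y + c * c * Q₂) + c * (c * (Q₂ - Q₁))
      ≡⟨ solve (A ∷ c ∷ y ∷ Q₁ ∷ Q₂ ∷ []) ⟩
    c * (c * (Q₂ - Q₁)) ∎)

  even-terms-mod-c² : ∀ a c s e → s * s ≡ a * c + + 4 → ∀ m → ∃[ Q ]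
    lucas s (+ 2 * e) (e * s + c) (2 ℕ.* m) ≡ + 2 * e + c * (e * a * (+ m * + m) + s * + m) + c * c * Q
  even-terms-mod-c² a c s e hs m =
    let Q , expansion = lucas-mod-c² a c (+ 2 * e) (e * a + s) m in Q , (begin
    lucas s (+ 2 * e) (e * s + c) (2 ℕ.* m)
      ≡⟨ cong (lucas s (+ 2 * e) (e * s + c)) (ℕ.+-identityʳ (2 ℕ.* m)) ⟨
    lucas s (+ 2 * e) (e * s + c) (2 ℕ.* m ℕ.+ 0)
      ≡⟨ lucas-bisect s (+ 2 * e) (e * s + c) 0 m ⟩
    lucas (s * s - + 2) (+ 2 * e) (s * (e * s + c) - + 2 * e) m
      ≡⟨ cong₂ (λ p y → lucas p (+ 2 * e) y m) (bisected-multiplier a c s hs) second-term ⟩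
    lucas (+ 2 + a * c) (+ 2 * e) (+ 2 * e + c * (e * a + s)) m
      ≡⟨ expansion ⟩
    + 2 * e + c * (+ m * (e * a + s) + a * (+ 2 * e) * + triangular m) + c * c * Q
      ≡⟨ cong (λ u → + 2 * e + c * u + c * c * Q) (regroup e a s (+ m) (+ triangular m)) ⟩
    + 2 * e + c * (e * a * (+ 2 * + triangular m + + m) + s * + m) + c * c * Q
      ≡⟨ cong (λ u → + 2 * e + c * (e * a * u + s * + m) + c * c * Q) (triangular-square m) ⟩
    + 2 * e + c * (e * a * (+ m * + m) + s * + m) + c * c * Q ∎)
    where
    second-term : s * (e * s + c) - + 2 * e ≡ + 2 * e + c * (e * a + s)
    second-term = begin
      s * (e * s + c) - + 2 * e     ≡⟨ solve (s ∷ e ∷ c ∷ []) ⟩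
      e * (s * s) + c * s - + 2 * e ≡⟨ cong (λ u → e * u + c * s - + 2 * e) hs ⟩
      e * (a * c + + 4) + c * s - + 2 * e ≡⟨ solve (a ∷ c ∷ s ∷ e ∷ []) ⟩
      + 2 * e + c * (e * a + s)     ∎
    regroup : ∀ e a s M T → M * (e * a + s) + a * (+ 2 * e) * T ≡ e * a * (+ 2 * T + M) + s * M
    regroup = solve-∀

  odd-terms-mod-c² : ∀ a c s z r → s * s ≡ a * c + + 4 → ∀ m → ∃[ Q ]
    lucas s (+ 2 * z) (s * z + c * r) (2 ℕ.* m ℕ.+ 1)
      ≡ s * z + c * r + c * (a * (s * z) * + triangular (suc m) + + 2 * r * + m) + c * c * Q
  odd-terms-mod-c² a c s z r hs m =
    let Q , expansion = lucas-mod-c² a c (s * z + c * r) (a * (s * z + c * r) + + 2 * r) m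
    in Q + a * r * (+ m + + triangular m) , (begin
    lucas s (+ 2 * z) (s * z + c * r) (2 ℕ.* m ℕ.+ 1)
      ≡⟨ lucas-bisect s (+ 2 * z) (s * z + c * r) 1 m ⟩
    lucas (s * s - + 2) (s * z + c * r) (s * (s * (s * z + c * r) - + 2 * z) - (s * z + c * r)) m
      ≡⟨ cong₂ (λ p y → lucas p (s * z + c * r) y m) (bisected-multiplier a c s hs) third-term ⟩
    lucas (+ 2 + a * c) (s * z + c * r) (s * z + c * r + c * (a * (s * z + c * r) + + 2 * r)) m
      ≡⟨ expansion ⟩
    s * z + c * r + c * (+ m * (a * (s * z + c * r) + + 2 * r) + a * (s * z + c * r) * + triangular m) + c * c * Q
      ≡⟨ regroup a c s z r (+ m) (+ triangular m) Q ⟩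
    s * z + c * r + c * (a * (s * z) * (+ triangular m + + m) + + 2 * r * + m)
      + c * c * (Q + a * r * (+ m + + triangular m)) ∎)
    where
    third-term : s * (s * (s * z + c * r) - + 2 * z) - (s * z + c * r) ≡ s * z + c * r + c * (a * (s * z + c * r) + + 2 * r)
    third-term = begin
      s * (s * (s * z + c * r) - + 2 * z) - (s * z + c * r)
        ≡⟨ solve (s ∷ z ∷ c ∷ r ∷ []) ⟩
      (s * s) * (s * z + c * r) - + 2 * (s * z) - (s * z + c * r)
        ≡⟨ cong (λ u → u * (s * z + c * r) - + 2 * (s * z) - (s * z + c * r)) hs ⟩
      (a * c + + 4) * (s * z + c * r) - + 2 * (s * z) - (s * z + c * r)
        ≡⟨ solve (a ∷ c ∷ s ∷ z ∷ r ∷ []) ⟩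
      s * z + c * r + c * (a * (s * z + c * r) + + 2 * r) ∎
    regroup : ∀ a c s z r M T Q →
      s * z + c * r + c * (M * (a * (s * z + c * r) + + 2 * r) + a * (s * z + c * r) * T) + c * c * Q
        ≡ s * z + c * r + c * (a * (s * z) * (T + M) + + 2 * r * M) + c * c * (Q + a * r * (M + T))
    regroup = solve-∀

  even-congruence : ∀ a b c s t e m n .{{_ : NonZero c}} → s * s ≡ a * c + + 4 → t * t ≡ b * c + + 4 →
    lucas s (+ 2 * e) (e * s + c) (2 ℕ.* m) ≡ lucas t (+ 2 * e) (e * t + c) (2 ℕ.* n) →
    ∃[ J ] e * a * (+ m * + m) + s * + m - (e * b * (+ n * + n) + t * + n) ≡ c * J
  even-congruence a b c s t e m n hs ht eq =
    let Q₁ , e₁ = even-terms-mod-c² a c s e hs m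
        Q₂ , e₂ = even-terms-mod-c² b c t e ht n
    in Q₂ - Q₁ , mod-c²⇒mod-c (+ 2 * e) c _ _ Q₁ Q₂ (trans (sym e₁) (trans eq e₂))

  odd-congruence : ∀ a b c s t z₀ z₁ r m n .{{_ : NonZero c}} →
    s * s ≡ a * c + + 4 → t * t ≡ b * c + + 4 → s * z₀ ≡ t * z₁ →
    lucas s (+ 2 * z₀) (s * z₀ + c * r) (2 ℕ.* m ℕ.+ 1) ≡ lucas t (+ 2 * z₁) (t * z₁ + c * r) (2 ℕ.* n ℕ.+ 1) →
    ∃[ J ] a * (s * z₀) * + triangular (suc m) + + 2 * r * + m
             - (b * (s * z₀) * + triangular (suc n) + + 2 * r * + n) ≡ c * J
  odd-congruence a b c s t z₀ z₁ r m n hs ht g≡ eq =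
    let Q₁ , e₁ = odd-terms-mod-c² a c s z₀ r hs m
        Q₂ , e₂ = odd-terms-mod-c² b c t z₁ r ht n
        g = s * z₀
    in Q₂ - Q₁ , mod-c²⇒mod-c (g + c * r) c _ _ Q₁ Q₂ (trans (sym e₁) (trans eq (trans e₂
         (cong (λ h → h + c * r + c * (b * h * + triangular (suc n) + + 2 * r * + n) + c * c * Q₂) (sym g≡)))))

  squared-congruence : ∀ a b c g r X D J → g * g ≡ (a * c + + 4) * (b * c + + 4) → g * X + + 2 * (r * D) ≡ c * J →
    + 16 * (X * X) - + 4 * ((r * D) * (r * D))
      ≡ c * (J * (c * J - + 4 * (r * D)) - (a * b * c + + 4 * a + + 4 * b) * (X * X))
  squared-congruence a b c g r X D J g² lin = begin
    + 16 * (X * X) - + 4 * ((r * D) * (r * D))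
      ≡⟨ solve (g ∷ r ∷ X ∷ D ∷ []) ⟩
    (g * X + + 2 * (r * D)) * (g * X + + 2 * (r * D) - + 4 * (r * D)) - (g * g - + 16) * (X * X)
      ≡⟨ cong₂ (λ u w → u * (u - + 4 * (r * D)) - (w - + 16) * (X * X)) lin g² ⟩
    c * J * (c * J - + 4 * (r * D)) - ((a * c + + 4) * (b * c + + 4) - + 16) * (X * X)
      ≡⟨ solve (a ∷ b ∷ c ∷ r ∷ X ∷ D ∷ J ∷ []) ⟩
    c * (J * (c * J - + 4 * (r * D)) - (a * b * c + + 4 * a + + 4 * b) * (X * X)) ∎

module Inequalities where

  open import Data.Nat.Base
  open import Data.Nat.Properties
  open import Data.Nat.Tactic.RingSolver using (solve)
  open import Data.List.Base using (_∷_; [])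
  open import Relation.Binary.PropositionalEquality
  open import Relation.Nullary using (contradiction; yes; no)

  f*x+g≡f*y+h⇒f+h≤g : ∀ f {x y g h} → f * x + g ≡ f * y + h → h < g → f + h ≤ g
  f*x+g≡f*y+h⇒f+h≤g f {x} {y} {g} {h} eq h<g with y ≤? x
  ... | yes y≤x = contradiction (+-mono-≤-< (*-monoʳ-≤ f y≤x) h<g) (<-irrefl (sym eq))
  ... | no y≰x = +-cancelˡ-≤ (f * x) (f + h) g (begin
    f * x + (f + h) ≡⟨ solve (f ∷ x ∷ h ∷ []) ⟩
    f * suc x + h   ≤⟨ +-monoˡ-≤ h (*-monoʳ-≤ f (≰⇒> y≰x)) ⟩
    f * y + h       ≡⟨ eq ⟨
    f * x + g       ∎)
    where open ≤-Reasoning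

  m*m≤n*n⇒m≤n : ∀ {m n} → m * m ≤ n * n → m ≤ n
  m*m≤n*n⇒m≤n m*m≤n*n = ≮⇒≥ λ n<m → <⇒≱ (*-mono-< n<m n<m) m*m≤n*n

  m*m<n*n⇒m<n : ∀ {m n} → m * m < n * n → m < n
  m*m<n*n⇒m<n m*m<n*n = ≰⇒> λ n≤m → <⇒≱ m*m<n*n (*-mono-≤ n≤m n≤m)
module PellIdentities where

  open import Data.Nat.Base
  open import Data.Nat.Properties
  open import Data.Nat.Tactic.RingSolver using (solve)
  open import Data.List.Base using (_∷_; [])
  open import Relation.Binary.PropositionalEquality
  open ≡-Reasoning

  pell-square : ∀ a c s m → s * s ≡ a * c + 4 → (s * m) * (s * m) ≡ c * (a * (m * m)) + 4 * (m * m)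
  pell-square a c s m hs = begin
    (s * m) * (s * m)               ≡⟨ solve (s ∷ m ∷ []) ⟩
    (s * s) * (m * m)               ≡⟨ cong (_* (m * m)) hs ⟩
    (a * c + 4) * (m * m)           ≡⟨ solve (a ∷ c ∷ m ∷ []) ⟩
    c * (a * (m * m)) + 4 * (m * m) ∎

  cross-identity : ∀ u v p q → u + p ≡ v + q → p * p + (p + q) * u ≡ q * q + (p + q) * v
  cross-identity u v p q eq = begin
    p * p + (p + q) * u ≡⟨ solve (u ∷ p ∷ q ∷ []) ⟩
    p * (u + p) + q * u ≡⟨ cong (λ w → p * w + q * u) eq ⟩
    p * (v + q) + q * u ≡⟨ solve (u ∷ v ∷ p ∷ q ∷ []) ⟩
    q * (u + p) + p * v ≡⟨ cong (λ w → q * w + p * v) eq ⟩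
    q * (v + q) + p * v ≡⟨ solve (v ∷ p ∷ q ∷ []) ⟩
    q * q + (p + q) * v ∎

  solution-identity⁺ : ∀ c x y M N p q → p * p ≡ c * x + 4 * M → q * q ≡ c * y + 4 * N →
    x + p ≡ y + q → (c + (p + q)) * x + 4 * M ≡ (c + (p + q)) * y + 4 * N
  solution-identity⁺ c x y M N p q hp hq eq = begin
    (c + (p + q)) * x + 4 * M     ≡⟨ solve (c ∷ x ∷ M ∷ p ∷ q ∷ []) ⟩
    (c * x + 4 * M) + (p + q) * x ≡⟨ cong (_+ (p + q) * x) hp ⟨
    p * p + (p + q) * x           ≡⟨ cross-identity x y p q eq ⟩
    q * q + (p + q) * y           ≡⟨ cong (_+ (p + q) * y) hq ⟩
    (c * y + 4 * N) + (p + q) * y ≡⟨ solve (c ∷ y ∷ N ∷ p ∷ q ∷ []) ⟩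
    (c + (p + q)) * y + 4 * N     ∎

  solution-identity⁻ : ∀ h x y M N p q → p * p ≡ (p + q + h) * x + 4 * M → q * q ≡ (p + q + h) * y + 4 * N →
    y + p ≡ x + q → h * x + 4 * M ≡ h * y + 4 * N
  solution-identity⁻ h x y M N p q hp hq eq = +-cancelˡ-≡ ((p + q) * (x + y)) _ _ (begin
    (p + q) * (x + y) + (h * x + 4 * M)     ≡⟨ solve (h ∷ x ∷ y ∷ M ∷ p ∷ q ∷ []) ⟩
    ((p + q + h) * x + 4 * M) + (p + q) * y ≡⟨ cong (_+ (p + q) * y) hp ⟨
    p * p + (p + q) * y                     ≡⟨ cross-identity y x p q eq ⟩
    q * q + (p + q) * x                     ≡⟨ cong (_+ (p + q) * x) hq ⟩
    ((p + q + h) * y + 4 * N) + (p + q) * x ≡⟨ solve (h ∷ x ∷ y ∷ N ∷ p ∷ q ∷ []) ⟩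
    (p + q) * (x + y) + (h * y + 4 * N)     ∎)

module Casts where

  open import Data.Nat.Base as ℕ using (_⊔_)
  import Data.Nat.Properties as ℕ
  open import Data.Integer.Base as ℤ using (+_; -_; ∣_∣; 0ℤ; -[1+_]; _<_)
  import Data.Integer.Properties as ℤ
  open import Relation.Binary.PropositionalEquality
  open import Relation.Nullary using (¬_)
  open import Function.Base using (_∘_)

  ∣+m-+n∣≤m⊔n : ∀ m n → ∣ + m ℤ.- + n ∣ ℕ.≤ m ⊔ n
  ∣+m-+n∣≤m⊔n m n = subst (ℕ._≤ m ⊔ n) (cong ∣_∣ (sym (ℤ.m-n≡m⊖n m n))) (ℤ.∣m⊝n∣≤m⊔n m n)

  +m-+n≡+[m∸n] : ∀ {m n} → n ℕ.≤ m → + m ℤ.- + n ≡ + (m ℕ.∸ n)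
  +m-+n≡+[m∸n] {m} {n} n≤m = trans (ℤ.m-n≡m⊖n m n) (ℤ.≤-⊖ n≤m)

  i*i≡+∣i∣*∣i∣ : ∀ i → i ℤ.* i ≡ + (∣ i ∣ ℕ.* ∣ i ∣)
  i*i≡+∣i∣*∣i∣ (+ n) = sym (ℤ.pos-* n n)
  i*i≡+∣i∣*∣i∣ -[1+ n ] = refl

  +k*[i*i]≡+[k*∣i∣²] : ∀ k i → + k ℤ.* (i ℤ.* i) ≡ + (k ℕ.* (∣ i ∣ ℕ.* ∣ i ∣))
  +k*[i*i]≡+[k*∣i∣²] k i = trans (cong (+ k ℤ.*_) (i*i≡+∣i∣*∣i∣ i)) (sym (ℤ.pos-* k _))

  ≡-mod-below⇒≡ : ∀ {m n c} j → + m ℤ.- + n ≡ + c ℤ.* j → m ℕ.< c → n ℕ.< c → m ≡ n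
  ≡-mod-below⇒≡ {m} {n} {c} j eq m<c n<c =
    ℤ.+-injective (ℤ.i-j≡0⇒i≡j (+ m) (+ n) (trans eq (trans (cong (+ c ℤ.*_) j≡0) (ℤ.*-zeroʳ (+ c)))))
    where
    open ℕ.≤-Reasoning
    j≡0 : j ≡ 0ℤ
    j≡0 = ℤ.∣i∣≡0⇒i≡0 (ℕ.n<1⇒n≡0 (ℕ.*-cancelˡ-< c ∣ j ∣ 1 (begin-strict
      c ℕ.* ∣ j ∣      ≡⟨ ℤ.abs-* (+ c) j ⟨
      ∣ + c ℤ.* j ∣    ≡⟨ cong ∣_∣ eq ⟨
      ∣ + m ℤ.- + n ∣  ≤⟨ ∣+m-+n∣≤m⊔n m n ⟩
      m ⊔ n            <⟨ ℕ.⊔-lub m<c n<c ⟩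
      c                ≡⟨ ℕ.*-identityʳ c ⟨
      c ℕ.* 1          ∎)))

  0≮+m*-+n : ∀ m n → ¬ (0ℤ < + m ℤ.* - + n)
  0≮+m*-+n m n = ℤ.≤⇒≯ ℤ.neg-≤-pos ∘ subst (0ℤ <_) +m*-+n≡-+[m*n]
    where
    +m*-+n≡-+[m*n] : + m ℤ.* - + n ≡ - + (m ℕ.* n)
    +m*-+n≡-+[m*n] = trans (sym (ℤ.neg-distribʳ-* (+ m) (+ n))) (cong -_ (sym (ℤ.pos-* m n)))

  pos-quadratic : ∀ x y z w → + (x ℕ.* (y ℕ.* y) ℕ.+ z ℕ.* w) ≡ + x ℤ.* (+ y ℤ.* + y) ℤ.+ + z ℤ.* + w
  pos-quadratic x y z w = cong₂ ℤ._+_ (trans (ℤ.pos-* x (y ℕ.* y)) (cong (+ x ℤ.*_) (ℤ.pos-* y y))) (ℤ.pos-* z w)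

module EvenIndexSolutions
  (a b c s t m n : ℕ) (hs : s ℕ.* s ≡ a ℕ.* c ℕ.+ 4) (ht : t ℕ.* t ≡ b ℕ.* c ℕ.+ 4)
  (a≤b : a ℕ.≤ b) (n<m : n ℕ.< m)
  (small : b ℕ.* (m ℕ.* m) ℕ.+ t ℕ.* m ℕ.< c) (tiny : 2 ℕ.* (t ℕ.* m) ℕ.+ 4 ℕ.* (m ℕ.* m) ℕ.< c) where

  open import Data.Nat.Base
  open import Data.Nat.Properties
  open import Data.Nat.Tactic.RingSolver using (solve)
  open import Data.List.Base using (_∷_; [])
  open import Data.Empty using (⊥)
  open import Relation.Binary.PropositionalEquality
  open ≤-Reasoning
  open Inequalities
  open PellIdentities
  open Casts using (≡-mod-below⇒≡)

  private
    n≤m : n ≤ m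
    n≤m = <⇒≤ n<m

    s≤t : s ≤ t
    s≤t = m*m≤n*n⇒m≤n (begin
      s * s     ≡⟨ hs ⟩
      a * c + 4 ≤⟨ +-monoˡ-≤ 4 (*-monoˡ-≤ c a≤b) ⟩
      b * c + 4 ≡⟨ ht ⟨
      t * t     ∎)

    below-c : ∀ {x y} → x ≤ b * (m * m) → y ≤ t * m → x + y < c
    below-c x≤ y≤ = ≤-<-trans (+-mono-≤ x≤ y≤) small

    aM≤bM : a * (m * m) ≤ b * (m * m)
    aM≤bM = *-monoˡ-≤ (m * m) a≤b

    bN≤bM : b * (n * n) ≤ b * (m * m)
    bN≤bM = *-monoʳ-≤ b (*-mono-≤ n≤m n≤m)

    sm≤tm : s * m ≤ t * m
    sm≤tm = *-monoˡ-≤ m s≤t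

    tn≤tm : t * n ≤ t * m
    tn≤tm = *-monoʳ-≤ t n≤m

    sm+tn≤2tm : s * m + t * n ≤ 2 * (t * m)
    sm+tn≤2tm = ≤-trans (+-mono-≤ sm≤tm tn≤tm) (≤-reflexive (solve (t ∷ m ∷ [])))

    4N<4M : 4 * (n * n) < 4 * (m * m)
    4N<4M = *-monoʳ-< 4 (*-mono-< n<m n<m)

    p² : (s * m) * (s * m) ≡ c * (a * (m * m)) + 4 * (m * m)
    p² = pell-square a c s m hs

    q² : (t * n) * (t * n) ≡ c * (b * (n * n)) + 4 * (n * n)
    q² = pell-square b c t n ht

  no-solution⁺ : a * (m * m) + s * m ≡ b * (n * n) + t * n → ⊥
  no-solution⁺ eq = <⇒≱ tiny (begin
    c                                 ≤⟨ m≤m+n c _ ⟩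
    c + G                             ≤⟨ m≤m+n _ _ ⟩
    c + G + 4 * (n * n)               ≤⟨ f*x+g≡f*y+h⇒f+h≤g (c + G) identity 4N<4M ⟩
    4 * (m * m)                       ≤⟨ m≤n+m (4 * (m * m)) (2 * (t * m)) ⟩
    2 * (t * m) + 4 * (m * m)         ∎)
    where
    G = s * m + t * n
    identity = solution-identity⁺ c (a * (m * m)) (b * (n * n)) (m * m) (n * n) (s * m) (t * n) p² q² eq

  no-solution⁻ : b * (n * n) + s * m ≡ a * (m * m) + t * n → ⊥
  no-solution⁻ eq = <⇒≱ tiny (begin
    c                               ≡⟨ G+H≡c ⟨
    G + H                           ≤⟨ +-monoʳ-≤ G (≤-trans (m≤m+n H _) (f*x+g≡f*y+h⇒f+h≤g H identity 4N<4M)) ⟩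
    G + 4 * (m * m)                 ≤⟨ +-monoˡ-≤ _ sm+tn≤2tm ⟩
    2 * (t * m) + 4 * (m * m)       ∎)
    where
    G = s * m + t * n
    H = c ∸ G
    G+H≡c : G + H ≡ c
    G+H≡c = m+[n∸m]≡n (≤-trans sm+tn≤2tm (≤-trans (m≤m+n _ _) (<⇒≤ tiny)))
    identity = solution-identity⁻ H (a * (m * m)) (b * (n * n)) (m * m) (n * n) (s * m) (t * n)
      (subst (λ c → (s * m) * (s * m) ≡ c * (a * (m * m)) + 4 * (m * m)) (sym G+H≡c) p²)
      (subst (λ c → (t * n) * (t * n) ≡ c * (b * (n * n)) + 4 * (n * n)) (sym G+H≡c) q²) eq

  no-congruent-solution⁺ : ∀ j → + (a * (m * m) + s * m) ℤ.- + (b * (n * n) + t * n) ≡ + c ℤ.* j → ⊥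
  no-congruent-solution⁺ j eq = no-solution⁺ (≡-mod-below⇒≡ j eq (below-c aM≤bM sm≤tm) (below-c bN≤bM tn≤tm))

  no-congruent-solution⁻ : ∀ j → + (b * (n * n) + s * m) ℤ.- + (a * (m * m) + t * n) ≡ + c ℤ.* j → ⊥
  no-congruent-solution⁻ j eq = no-solution⁻ (≡-mod-below⇒≡ j eq (below-c bN≤bM sm≤tm) (below-c aM≤bM tn≤tm))

module EvenSizeBounds where

  open import Data.Nat.Base
  open import Data.Nat.Properties
  open import Data.Nat.Tactic.RingSolver using (solve)
  open import Data.List.Base using (_∷_; [])
  open import Data.Product.Base using (_×_; _,_)
  open import Relation.Binary.PropositionalEquality
  open ≤-Reasoning
  open Inequalities

  -- 245025 = 495² and 9801 = 99²: the hypothesis is 40000·bm² ≤ 99²·c, whence 200·tm ≤ 99·c.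
  even-size-bounds : ∀ b c t m .{{_ : NonZero c}} → t * t ≡ b * c + 4 → 100000 < b →
    1000000 * b * (m * m) ≤ 245025 * c → b * (m * m) + t * m < c × 2 * (t * m) + 4 * (m * m) < c
  even-size-bounds b c t m ht b>10⁵ h = small , tiny
    where
    bM≤c : 40000 * (b * (m * m)) ≤ 9801 * c
    bM≤c = *-cancelˡ-≤ 25 (begin
      25 * (40000 * (b * (m * m))) ≡⟨ *-assoc 25 40000 (b * (m * m)) ⟨
      1000000 * (b * (m * m))      ≡⟨ *-assoc 1000000 b (m * m) ⟨
      1000000 * b * (m * m)        ≤⟨ h ⟩
      245025 * c                   ≡⟨ *-assoc 25 9801 c ⟩
      25 * (9801 * c)              ∎)
    M≤c : 400000 * (m * m) ≤ c
    M≤c = *-cancelˡ-≤ 9801 (begin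
      9801 * (400000 * (m * m))  ≡⟨ *-assoc 9801 400000 (m * m) ⟨
      3920400000 * (m * m)       ≤⟨ *-monoˡ-≤ (m * m) (≤ᵇ⇒≤ 3920400000 4000000000 _) ⟩
      4000000000 * (m * m)       ≡⟨ *-assoc 40000 100000 (m * m) ⟩
      40000 * (100000 * (m * m)) ≤⟨ *-monoʳ-≤ 40000 (*-monoˡ-≤ (m * m) (<⇒≤ b>10⁵)) ⟩
      40000 * (b * (m * m))      ≤⟨ bM≤c ⟩
      9801 * c                   ∎)
    tm≤c : 200 * (t * m) ≤ 99 * c
    tm≤c = s≤s⁻¹ (m*m<n*n⇒m<n (begin-strict
      (200 * (t * m)) * (200 * (t * m))              ≡⟨ solve (t ∷ m ∷ []) ⟩
      40000 * (t * t) * (m * m)                      ≡⟨ cong (λ x → 40000 * x * (m * m)) ht ⟩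
      40000 * (b * c + 4) * (m * m)                  ≡⟨ solve (b ∷ c ∷ m ∷ []) ⟩
      c * (40000 * (b * (m * m))) + 160000 * (m * m) ≤⟨ +-mono-≤ (*-monoʳ-≤ c bM≤c)
                                                         (≤-trans (*-monoˡ-≤ (m * m) (≤ᵇ⇒≤ 160000 400000 _)) M≤c) ⟩
      c * (9801 * c) + c                             ≤⟨ +-monoʳ-≤ (c * (9801 * c)) (m≤n*m c 198) ⟩
      c * (9801 * c) + 198 * c                       <⟨ n<1+n _ ⟩
      1 + (c * (9801 * c) + 198 * c)                 ≡⟨ solve (c ∷ []) ⟩
      (1 + 99 * c) * (1 + 99 * c)                    ∎))
    small : b * (m * m) + t * m < c
    small = *-cancelˡ-< 200 _ _ (begin-strict
      200 * (b * (m * m) + t * m)         ≡⟨ *-distribˡ-+ 200 (b * (m * m)) (t * m) ⟩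
      200 * (b * (m * m)) + 200 * (t * m) ≤⟨ +-mono-≤ bM≤50c tm≤c ⟩
      50 * c + 99 * c                     ≡⟨ *-distribʳ-+ c 50 99 ⟨
      149 * c                             <⟨ *-monoˡ-< c (≤ᵇ⇒≤ 150 200 _) ⟩
      200 * c                             ∎)
      where
      bM≤50c : 200 * (b * (m * m)) ≤ 50 * c
      bM≤50c = *-cancelˡ-≤ 200 (begin
        200 * (200 * (b * (m * m))) ≡⟨ *-assoc 200 200 (b * (m * m)) ⟨
        40000 * (b * (m * m))       ≤⟨ bM≤c ⟩
        9801 * c                    ≤⟨ *-monoˡ-≤ c (≤ᵇ⇒≤ 9801 10000 _) ⟩
        10000 * c                   ≡⟨ *-assoc 200 50 c ⟩
        200 * (50 * c)              ∎)
    tiny : 2 * (t * m) + 4 * (m * m) < c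
    tiny = *-cancelˡ-< 200 _ _ (begin-strict
      200 * (2 * (t * m) + 4 * (m * m))        ≡⟨ solve (t ∷ m ∷ []) ⟩
      2 * (200 * (t * m)) + 800 * (m * m)      ≤⟨ +-mono-≤ (*-monoʳ-≤ 2 tm≤c)
                                                   (≤-trans (*-monoˡ-≤ (m * m) (≤ᵇ⇒≤ 800 400000 _)) M≤c) ⟩
      2 * (99 * c) + c                         ≡⟨ solve (c ∷ []) ⟩
      199 * c                                  <⟨ *-monoˡ-< c (≤ᵇ⇒≤ 200 200 _) ⟩
      200 * c                                  ∎)

module EvenIndexBound where

  open import Data.Nat.Base as ℕ using (ℕ; NonZero)
  import Data.Nat.Properties as ℕ
  open import Data.Integer.Base as ℤ using (ℤ; +_; -_; -[1+_]; _*_; _+_; _-_)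
  import Data.Integer.Properties as ℤ
  open import Data.Integer.Tactic.RingSolver using (solve-∀; solve)
  open import Data.List.Base using (_∷_; [])
  open import Data.Product.Base using (∃-syntax; _,_; proj₁; proj₂)
  open import Data.Sum.Base using (_⊎_; inj₁; inj₂)
  open import Data.Empty using (⊥)
  open import Relation.Binary.PropositionalEquality
  open import Relation.Nullary using (¬_)
  open ≡-Reasoning
  open Lucas
  open Rationals
  open Congruences
  open Casts
  open EvenSizeBounds

  EvenSolutionBound : (b c s t : ℤ) → Set
  EvenSolutionBound b c s t = (z₀ : ℤ) (m n : ℕ) → (z₀ ≡ + 2 ⊎ z₀ ≡ - + 2) →
    2 ℕ.< n → n ℕ.< m → m ℕ.< 2 ℕ.* n → 1 ℕ.< n →
    vseq s c z₀ (+ 2) (2 ℕ.* m) ≡ wseq t c z₀ (+ 2) (2 ℕ.* n) →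
    + 245025 * c ℤ.< + 1000000 * b * + (m ℕ.* m)

  lucas-halve : ∀ s c e n → lucas s (+ 2 * (+ 2 * e)) (s * (+ 2 * e) + c * + 2) n ≡ + 2 * lucas s (+ 2 * e) (e * s + c) n
  lucas-halve s c e n = trans (cong (λ y → lucas s (+ 2 * (+ 2 * e)) y n) (begin
    s * (+ 2 * e) + c * + 2 ≡⟨ solve (s ∷ c ∷ e ∷ []) ⟩
    + 2 * (e * s + c)       ∎)) (lucas-*ˡ s (+ 2) (+ 2 * e) (e * s + c) n)

  pell-ℕ : ∀ a c s → + a * + c + + 4 ≡ + s * + s → s ℕ.* s ≡ a ℕ.* c ℕ.+ 4
  pell-ℕ a c s eq = ℤ.+-injective (trans (ℤ.pos-* s s) (trans (sym eq) (cong (_+ + 4) (sym (ℤ.pos-* a c)))))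

  -- For z₀ = 2e and x₀ = 2 the sequence v is integral, and (i) needs v modulo c², not just 2v.
  halved-equation : ∀ s t c e m n → vseq s c (+ 2 * e) (+ 2) (2 ℕ.* m) ≡ wseq t c (+ 2 * e) (+ 2) (2 ℕ.* n) →
    lucas s (+ 2 * e) (e * s + c) (2 ℕ.* m) ≡ lucas t (+ 2 * e) (e * t + c) (2 ℕ.* n)
  halved-equation s t c e m n eq = ℤ.*-cancelˡ-≡ (+ 2) _ _ (begin
    + 2 * lucas s (+ 2 * e) (e * s + c) (2 ℕ.* m)                 ≡⟨ lucas-halve s c e (2 ℕ.* m) ⟨
    lucas s (+ 2 * (+ 2 * e)) (s * (+ 2 * e) + c * + 2) (2 ℕ.* m)
      ≡⟨ vseq≡wseq⇒lucas≡lucas s t c (+ 2 * e) (+ 2 * e) (+ 2) (+ 2) (2 ℕ.* m) (2 ℕ.* n) eq ⟩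
    lucas t (+ 2 * (+ 2 * e)) (t * (+ 2 * e) + c * + 2) (2 ℕ.* n) ≡⟨ lucas-halve t c e (2 ℕ.* n) ⟩
    + 2 * lucas t (+ 2 * e) (e * t + c) (2 ℕ.* n)                 ∎)

  no-small-even-solution : ∀ a b c s t m n z₀ .{{_ : NonZero c}} → a ℕ.≤ b → 100000 ℕ.< b →
    + a * + c + + 4 ≡ + s * + s → + b * + c + + 4 ≡ + t * + t → n ℕ.< m → z₀ ≡ + 2 ⊎ z₀ ≡ - + 2 →
    vseq (+ s) (+ c) z₀ (+ 2) (2 ℕ.* m) ≡ wseq (+ t) (+ c) z₀ (+ 2) (2 ℕ.* n) →
    ¬ (1000000 ℕ.* b ℕ.* (m ℕ.* m) ℕ.≤ 245025 ℕ.* c)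
  no-small-even-solution a b c s t m n z₀ a≤b b>10⁵ hs ht n<m z₀≡±2 v≡w h = sign-cases z₀≡±2 v≡w
    where
    bounds = even-size-bounds b c t m (pell-ℕ b c t ht) b>10⁵ h
    open EvenIndexSolutions a b c s t m n (pell-ℕ a c s hs) (pell-ℕ b c t ht) a≤b n<m (proj₁ bounds) (proj₂ bounds)
    congruence : ∀ e → vseq (+ s) (+ c) (+ 2 * e) (+ 2) (2 ℕ.* m) ≡ wseq (+ t) (+ c) (+ 2 * e) (+ 2) (2 ℕ.* n) →
      ∃[ j ] e * + a * (+ m * + m) + + s * + m - (e * + b * (+ n * + n) + + t * + n) ≡ + c * j
    congruence e eq =
      even-congruence (+ a) (+ b) (+ c) (+ s) (+ t) e m n (sym hs) (sym ht) (halved-equation (+ s) (+ t) (+ c) e m n eq)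
    sign-cases : z₀ ≡ + 2 ⊎ z₀ ≡ - + 2 →
      vseq (+ s) (+ c) z₀ (+ 2) (2 ℕ.* m) ≡ wseq (+ t) (+ c) z₀ (+ 2) (2 ℕ.* n) → ⊥
    sign-cases (inj₁ refl) eq = let j , j-eq = congruence (+ 1) eq in no-congruent-solution⁺ j (begin
      + (a ℕ.* (m ℕ.* m) ℕ.+ s ℕ.* m) - + (b ℕ.* (n ℕ.* n) ℕ.+ t ℕ.* n)
        ≡⟨ cong₂ _-_ (pos-quadratic a m s m) (pos-quadratic b n t n) ⟩
      (+ a * (+ m * + m) + + s * + m) - (+ b * (+ n * + n) + + t * + n)
        ≡⟨ unit⁺ (+ a) (+ b) (+ s) (+ t) (+ m * + m) (+ n * + n) (+ m) (+ n) ⟩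
      + 1 * + a * (+ m * + m) + + s * + m - (+ 1 * + b * (+ n * + n) + + t * + n)
        ≡⟨ j-eq ⟩
      + c * j ∎)
      where
      unit⁺ : ∀ A B S T M N m n → (A * M + S * m) - (B * N + T * n) ≡ + 1 * A * M + S * m - (+ 1 * B * N + T * n)
      unit⁺ = solve-∀
    sign-cases (inj₂ refl) eq = let j , j-eq = congruence (- + 1) eq in no-congruent-solution⁻ j (begin
      + (b ℕ.* (n ℕ.* n) ℕ.+ s ℕ.* m) - + (a ℕ.* (m ℕ.* m) ℕ.+ t ℕ.* n)
        ≡⟨ cong₂ _-_ (pos-quadratic b n s m) (pos-quadratic a m t n) ⟩
      (+ b * (+ n * + n) + + s * + m) - (+ a * (+ m * + m) + + t * + n)
        ≡⟨ unit⁻ (+ a) (+ b) (+ s) (+ t) (+ m * + m) (+ n * + n) (+ m) (+ n) ⟩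
      - + 1 * + a * (+ m * + m) + + s * + m - (- + 1 * + b * (+ n * + n) + + t * + n)
        ≡⟨ j-eq ⟩
      + c * j ∎)
      where
      unit⁻ : ∀ A B S T M N m n → (B * N + S * m) - (A * M + T * n) ≡ - + 1 * A * M + S * m - (- + 1 * B * N + T * n)
      unit⁻ = solve-∀

  +[1000000*b*M] : ∀ b m → + 1000000 * + b * + (m ℕ.* m) ≡ + (1000000 ℕ.* b ℕ.* (m ℕ.* m))
  +[1000000*b*M] b m = sym (trans (ℤ.pos-* (1000000 ℕ.* b) (m ℕ.* m)) (cong (_* + (m ℕ.* m)) (ℤ.pos-* 1000000 b)))

  even-solution-bound : ∀ a b s t c → a ℕ.≤ b → 100000 ℕ.< b →
    + a * c + + 4 ≡ + s * + s → + b * c + + 4 ≡ + t * + t → EvenSolutionBound (+ b) c (+ s) (+ t)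
  even-solution-bound a b s t -[1+ c ] _ _ _ _ _ m _ _ _ _ _ _ _ =
    subst (-[1+ _ ] ℤ.<_) (sym (+[1000000*b*M] b m)) ℤ.-<+
  even-solution-bound a b s t (+ c) a≤b b>10⁵ hs ht z₀ m n z₀≡±2 _ n<m _ _ v≡w =
    ℤ.≰⇒> λ h → no-small-even-solution a b c s t m n z₀ {{c≢0 (ℕ-bound h)}}
                  a≤b b>10⁵ hs ht n<m z₀≡±2 v≡w (ℕ-bound h)
    where
    ℕ-bound : + 1000000 * + b * + (m ℕ.* m) ℤ.≤ + 245025 * + c → 1000000 ℕ.* b ℕ.* (m ℕ.* m) ℕ.≤ 245025 ℕ.* c
    ℕ-bound h = ℤ.drop‿+≤+ (subst₂ ℤ._≤_ (+[1000000*b*M] b m) (sym (ℤ.pos-* 245025 c)) h)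
    m≥1 : 1 ℕ.≤ m
    m≥1 = ℕ.≤-trans (ℕ.s≤s ℕ.z≤n) n<m
    0<L : 0 ℕ.< 1000000 ℕ.* b ℕ.* (m ℕ.* m)
    0<L = ℕ.*-mono-≤ (ℕ.*-mono-≤ (ℕ.≤ᵇ⇒≤ 1 1000000 _) (ℕ.≤-trans (ℕ.s≤s ℕ.z≤n) b>10⁵))
                     (ℕ.*-mono-≤ m≥1 m≥1)
    c≢0 : 1000000 ℕ.* b ℕ.* (m ℕ.* m) ℕ.≤ 245025 ℕ.* c → NonZero c
    c≢0 h = ℕ.>-nonZero (ℕ.*-cancelˡ-< 245025 0 c (ℕ.<-≤-trans 0<L h))

module OddSizeBounds where

  open import Data.Nat.Base
  open import Data.Nat.Properties
  open import Data.Nat.Tactic.RingSolver using (solve)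
  open import Data.List.Base using (_∷_; [])
  open import Data.Product.Base using (_×_; _,_)
  open import Relation.Binary.PropositionalEquality
  open ≤-Reasoning
  open Inequalities
  open Lucas using (triangular)

  triangular-suc≤square : ∀ m → triangular (suc m) ≤ m * m
  triangular-suc≤square zero = z≤n
  triangular-suc≤square (suc m) = begin
    triangular (suc m) + suc m       ≤⟨ +-monoˡ-≤ (suc m) (triangular-suc≤square m) ⟩
    m * m + (1 + m)                  ≤⟨ m≤m+n _ m ⟩
    m * m + (1 + m) + m              ≡⟨ solve (m ∷ []) ⟩
    (1 + m) * (1 + m)                ∎

  pell-root≤3a : ∀ a κ r → 4 ≤ a → κ ≤ 6 → κ * a * a + 4 ≡ r * r → r ≤ 3 * a
  pell-root≤3a a κ r a≥4 κ≤6 hr = m*m≤n*n⇒m≤n (begin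
    r * r                    ≡⟨ hr ⟨
    κ * a * a + 4            ≤⟨ +-mono-≤ (*-monoˡ-≤ a (*-monoˡ-≤ a κ≤6))
                                         (≤-trans (≤ᵇ⇒≤ 4 48 _) (*-monoʳ-≤ 3 (*-mono-≤ a≥4 a≥4))) ⟩
    6 * a * a + 3 * (a * a)  ≡⟨ solve (a ∷ []) ⟩
    3 * a * (3 * a)          ∎)

  c₃-bound : ∀ a b r → 4 ≤ a → 1 ≤ b → b ≤ 6 * a → r ≤ 3 * a →
    (a * b + 3) * (a * b + 3) * (a + b + 2 * r) < 16 * (a * a * b) * (a * a * b)
  c₃-bound a b r a≥4 b≥1 b≤6a r≤3a = begin-strict
    (a * b + 3) * (a * b + 3) * (a + b + 2 * r)
      ≤⟨ *-mono-≤ (*-mono-≤ ab+3≤2ab ab+3≤2ab) (+-mono-≤ (+-monoʳ-≤ a b≤6a) (*-monoʳ-≤ 2 r≤3a)) ⟩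
    (2 * (a * b)) * (2 * (a * b)) * (a + 6 * a + 2 * (3 * a))
      ≡⟨ solve (a ∷ b ∷ []) ⟩
    52 * (a * ((a * b) * (a * b)))
      <⟨ *-monoˡ-< (a * ((a * b) * (a * b))) {{>-nonZero (*-mono-≤ a≥1 (*-mono-≤ ab≥1 ab≥1))}} (≤ᵇ⇒≤ 53 64 _) ⟩
    64 * (a * ((a * b) * (a * b)))
      ≤⟨ *-monoˡ-≤ _ (*-monoʳ-≤ 16 a≥4) ⟩
    16 * a * (a * ((a * b) * (a * b)))
      ≡⟨ solve (a ∷ b ∷ []) ⟩
    16 * (a * a * b) * (a * a * b) ∎
    where
    a≥1 : 1 ≤ a
    a≥1 = ≤-trans (≤ᵇ⇒≤ 1 4 _) a≥4
    ab≥1 : 1 ≤ a * b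
    ab≥1 = *-mono-≤ a≥1 b≥1
    ab+3≤2ab : a * b + 3 ≤ 2 * (a * b)
    ab+3≤2ab = begin
      a * b + 3     ≤⟨ +-monoʳ-≤ (a * b) (≤-trans (≤ᵇ⇒≤ 3 4 _) (*-mono-≤ a≥4 b≥1)) ⟩
      a * b + a * b ≡⟨ solve (a ∷ b ∷ []) ⟩
      2 * (a * b)   ∎

  odd-size-bounds : ∀ a κ r c m n y → 4 ≤ a → 2 ≤ κ → r ≤ 3 * a → n < m → y ≤ κ * (m * m) →
    256 * (m * m * (κ * a)) * (m * m * (κ * a)) ≤ c →
    16 * ((a * y) * (a * y)) < c × 4 * ((r * (m ∸ n)) * (r * (m ∸ n))) < c
  odd-size-bounds a κ r c m n y a≥4 κ≥2 r≤3a n<m y≤κM h = ≤-<-trans P≤ 16Mb²<c , ≤-<-trans Q≤ 16Mb²<c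
    where
    m≥1 : 1 ≤ m
    m≥1 = ≤-trans (s≤s z≤n) n<m
    Mb≥1 : 1 ≤ m * m * (κ * a)
    Mb≥1 = *-mono-≤ (*-mono-≤ m≥1 m≥1) (*-mono-≤ (≤-trans (≤ᵇ⇒≤ 1 2 _) κ≥2) (≤-trans (≤ᵇ⇒≤ 1 4 _) a≥4))
    16Mb²<c : 16 * ((m * m * (κ * a)) * (m * m * (κ * a))) < c
    16Mb²<c = begin-strict
      16 * ((m * m * (κ * a)) * (m * m * (κ * a)))
        <⟨ *-monoˡ-< _ {{>-nonZero (*-mono-≤ Mb≥1 Mb≥1)}} (≤ᵇ⇒≤ 17 256 _) ⟩
      256 * ((m * m * (κ * a)) * (m * m * (κ * a))) ≡⟨ *-assoc 256 (m * m * (κ * a)) (m * m * (κ * a)) ⟨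
      256 * (m * m * (κ * a)) * (m * m * (κ * a))   ≤⟨ h ⟩
      c                                             ∎
    ay≤Mb : a * y ≤ m * m * (κ * a)
    ay≤Mb = begin
      a * y              ≤⟨ *-monoʳ-≤ a y≤κM ⟩
      a * (κ * (m * m))  ≡⟨ solve (a ∷ κ ∷ m ∷ []) ⟩
      m * m * (κ * a)    ∎
    rd≤2Mb : r * (m ∸ n) ≤ 2 * (κ * a) * (m * m)
    rd≤2Mb = *-mono-≤ (begin
      r            ≤⟨ r≤3a ⟩
      3 * a        ≤⟨ *-monoˡ-≤ a (≤ᵇ⇒≤ 3 4 _) ⟩
      4 * a        ≡⟨ *-assoc 2 2 a ⟩
      2 * (2 * a)  ≤⟨ *-monoʳ-≤ 2 (*-monoˡ-≤ a κ≥2) ⟩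
      2 * (κ * a)  ∎) (≤-trans (m∸n≤m m n) (m≤m*n m m {{>-nonZero m≥1}}))
    P≤ : 16 * ((a * y) * (a * y)) ≤ 16 * ((m * m * (κ * a)) * (m * m * (κ * a)))
    P≤ = *-monoʳ-≤ 16 (*-mono-≤ ay≤Mb ay≤Mb)
    Q≤ : 4 * ((r * (m ∸ n)) * (r * (m ∸ n))) ≤ 16 * ((m * m * (κ * a)) * (m * m * (κ * a)))
    Q≤ = begin
      4 * ((r * (m ∸ n)) * (r * (m ∸ n)))                    ≤⟨ *-monoʳ-≤ 4 (*-mono-≤ rd≤2Mb rd≤2Mb) ⟩
      4 * ((2 * (κ * a) * (m * m)) * (2 * (κ * a) * (m * m))) ≡⟨ solve (a ∷ κ ∷ m ∷ []) ⟩
      16 * ((m * m * (κ * a)) * (m * m * (κ * a)))            ∎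

module OddIndexSolutions where

  open import Data.Nat.Base
  open import Data.Nat.Properties
  open import Data.Nat.Tactic.RingSolver using (solve)
  open import Data.List.Base using (_∷_; [])
  open import Data.Product.Base using (∃-syntax; _,_; proj₁; proj₂)
  import Data.Integer.Base as ℤ
  open import Relation.Binary.PropositionalEquality
  open import Relation.Nullary using (¬_)
  open ≤-Reasoning
  open Inequalities
  open Casts using (≡-mod-below⇒≡)
  open OddSizeBounds

  square-bound : ∀ a κ r y d → κ * a * a + 4 ≡ r * r → 4 * ((a * y) * (a * y)) ≡ (r * d) * (r * d) → 1 ≤ d →
    a * a ≤ 4 * (d * d)
  square-bound a κ r y d hr eq d≥1 = ≤-trans (≤-reflexive (sym (+-identityʳ (a * a))))
    (f*x+g≡f*y+h⇒f+h≤g (a * a) identity (*-mono-≤ (≤ᵇ⇒≤ 1 4 _) (*-mono-≤ d≥1 d≥1)))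
    where
    identity : a * a * (κ * (d * d)) + 4 * (d * d) ≡ a * a * (4 * (y * y)) + 0
    identity = begin-equality
      a * a * (κ * (d * d)) + 4 * (d * d) ≡⟨ solve (a ∷ κ ∷ d ∷ []) ⟩
      (κ * a * a + 4) * (d * d)           ≡⟨ cong (_* (d * d)) hr ⟩
      (r * r) * (d * d)                   ≡⟨ solve (r ∷ d ∷ []) ⟩
      (r * d) * (r * d)                   ≡⟨ eq ⟨
      4 * ((a * y) * (a * y))             ≡⟨ solve (a ∷ y ∷ []) ⟩
      a * a * (4 * (y * y)) + 0           ∎

  no-small-odd-solution : ∀ a κ r c m n y → 2 ≤ κ → κ ≤ 6 → κ * a * a + 4 ≡ r * r → 4 ≤ a → n < m →
    y ≤ κ * (m * m) → c ≤ (a * (κ * a) + 3) * (a * (κ * a) + 3) * (a + κ * a + 2 * r) →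
    (∃[ j ] ℤ.+ (16 * ((a * y) * (a * y))) ℤ.- ℤ.+ (4 * ((r * (m ∸ n)) * (r * (m ∸ n)))) ≡ ℤ.+ c ℤ.* j) →
    ¬ (256 * (m * m * (κ * a)) * (m * m * (κ * a)) ≤ c)
  no-small-odd-solution a κ r c m n y κ≥2 κ≤6 hr a≥4 n<m y≤κM c≤c₃ (j , congruence) h =
    <⇒≱ (≤-<-trans c≤c₃ (c₃-bound a (κ * a) r a≥4 (*-mono-≤ κ≥1 a≥1) (*-monoˡ-≤ a κ≤6) r≤3a)) (begin
      16 * (a * a * (κ * a)) * (a * a * (κ * a))             ≤⟨ *-mono-≤ (*-monoʳ-≤ 16 aab≤4Mb) aab≤4Mb ⟩
      16 * (4 * (m * m) * (κ * a)) * (4 * (m * m) * (κ * a)) ≡⟨ solve (a ∷ κ ∷ m ∷ []) ⟩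
      256 * (m * m * (κ * a)) * (m * m * (κ * a))            ≤⟨ h ⟩
      c                                                      ∎)
    where
    a≥1 = ≤-trans (≤ᵇ⇒≤ 1 4 _) a≥4
    κ≥1 = ≤-trans (≤ᵇ⇒≤ 1 2 _) κ≥2
    r≤3a = pell-root≤3a a κ r a≥4 κ≤6 hr
    bounds = odd-size-bounds a κ r c m n y a≥4 κ≥2 r≤3a n<m y≤κM h
    P≡Q : 16 * ((a * y) * (a * y)) ≡ 4 * ((r * (m ∸ n)) * (r * (m ∸ n)))
    P≡Q = ≡-mod-below⇒≡ j congruence (proj₁ bounds) (proj₂ bounds)
    aa≤4dd : a * a ≤ 4 * ((m ∸ n) * (m ∸ n))
    aa≤4dd = square-bound a κ r y (m ∸ n) hr (*-cancelˡ-≡ _ _ 4 (E.begin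
      4 * (4 * ((a * y) * (a * y)))        E.≡⟨ *-assoc 4 4 ((a * y) * (a * y)) ⟨
      16 * ((a * y) * (a * y))             E.≡⟨ P≡Q ⟩
      4 * ((r * (m ∸ n)) * (r * (m ∸ n)))  E.∎)) (m<n⇒0<n∸m n<m)
      where module E = ≡-Reasoning
    aab≤4Mb : a * a * (κ * a) ≤ 4 * (m * m) * (κ * a)
    aab≤4Mb = *-monoˡ-≤ (κ * a) (≤-trans aa≤4dd (*-monoʳ-≤ 4 (*-mono-≤ (m∸n≤m m n) (m∸n≤m m n))))

module OddIndexBound where

  open import Data.Nat.Base as ℕ using (ℕ; NonZero; suc; _∸_)
  import Data.Nat.Properties as ℕ
  open import Data.Integer.Base as ℤ using (ℤ; +_; -_; -[1+_]; ∣_∣; _*_; _+_; _-_)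
  import Data.Integer.Properties as ℤ
  open import Data.Integer.Tactic.RingSolver using (solve-∀)
  open import Data.Product.Base using (∃-syntax; _×_; _,_)
  open import Data.Sum.Base using (_⊎_; inj₁; inj₂)
  open import Data.Empty using (⊥-elim)
  open import Relation.Binary.PropositionalEquality
  open Lucas
  open Rationals
  open Congruences
  open Casts
  open OddSizeBounds
  open OddIndexSolutions

  OddSolutionBound : (b c s t r : ℤ) → Set
  OddSolutionBound b c s t r = (z₀ z₁ : ℤ) (m n : ℕ) → (z₀ ≡ t ⊎ z₀ ≡ - t) → (z₁ ≡ s ⊎ z₁ ≡ - s) →
    + 0 ℤ.< z₀ * z₁ →
    2 ℕ.< n → n ℕ.< m → m ℕ.< 2 ℕ.* n → 1 ℕ.< n →
    vseq s c z₀ r (2 ℕ.* m ℕ.+ 1) ≡ wseq t c z₁ r (2 ℕ.* n ℕ.+ 1) →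
    c ℤ.< + 256 * (+ (m ℕ.* m) * b) * (+ (m ℕ.* m) * b)

  same-sign : ∀ s t {z₀ z₁} → (z₀ ≡ + t ⊎ z₀ ≡ - + t) → (z₁ ≡ + s ⊎ z₁ ≡ - + s) →
    + 0 ℤ.< z₀ * z₁ →
    + s * z₀ ≡ + t * z₁ × (+ s * z₀) * (+ s * z₀) ≡ (+ s * + s) * (+ t * + t)
  same-sign s t (inj₁ refl) (inj₁ refl) _ = ℤ.*-comm (+ s) (+ t) , square (+ s) (+ t)
    where
    square : ∀ S T → (S * T) * (S * T) ≡ (S * S) * (T * T)
    square = solve-∀
  same-sign s t (inj₂ refl) (inj₂ refl) _ = swap (+ s) (+ t) , square (+ s) (+ t)
    where
    swap : ∀ S T → S * - T ≡ T * - S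
    swap = solve-∀
    square : ∀ S T → (S * - T) * (S * - T) ≡ (S * S) * (T * T)
    square = solve-∀
  same-sign s t (inj₁ refl) (inj₂ refl) 0<z₀z₁ = ⊥-elim (0≮+m*-+n t s 0<z₀z₁)
  same-sign s t (inj₂ refl) (inj₁ refl) 0<z₀z₁ =
    ⊥-elim (0≮+m*-+n s t (subst (+ 0 ℤ.<_) (ℤ.*-comm (- + t) (+ s)) 0<z₀z₁))

  +256[Mb]² : ∀ b m →
    + 256 * (+ (m ℕ.* m) * + b) * (+ (m ℕ.* m) * + b) ≡ + (256 ℕ.* (m ℕ.* m ℕ.* b) ℕ.* (m ℕ.* m ℕ.* b))
  +256[Mb]² b m = sym (trans (ℤ.pos-* (256 ℕ.* Mb) Mb)
    (cong₂ _*_ (trans (ℤ.pos-* 256 Mb) (cong (+ 256 *_) (ℤ.pos-* (m ℕ.* m) b))) (ℤ.pos-* (m ℕ.* m) b)))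
    where Mb = m ℕ.* m ℕ.* b

  gap : ℕ → ℕ → ℕ → ℕ
  gap κ m n = ∣ + triangular (suc m) - + (κ ℕ.* triangular (suc n)) ∣

  gap≤κ*m*m : ∀ κ m n → 1 ℕ.≤ κ → n ℕ.≤ m → gap κ m n ℕ.≤ κ ℕ.* (m ℕ.* m)
  gap≤κ*m*m κ m n κ≥1 n≤m = ℕ.≤-trans (∣+m-+n∣≤m⊔n (triangular (suc m)) (κ ℕ.* triangular (suc n))) (ℕ.⊔-lub
    (ℕ.≤-trans (triangular-suc≤square m) (ℕ.m≤n*m (m ℕ.* m) κ {{ℕ.>-nonZero κ≥1}}))
    (ℕ.*-monoʳ-≤ κ (ℕ.≤-trans (triangular-suc≤square n) (ℕ.*-mono-≤ n≤m n≤m))))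

  odd-squared-congruence : ∀ κ a r s t c z₀ z₁ m n .{{_ : NonZero c}} →
    + a * + c + + 4 ≡ + s * + s → + (κ ℕ.* a) * + c + + 4 ≡ + t * + t → n ℕ.≤ m →
    (z₀ ≡ + t ⊎ z₀ ≡ - + t) → (z₁ ≡ + s ⊎ z₁ ≡ - + s) → + 0 ℤ.< z₀ * z₁ →
    vseq (+ s) (+ c) z₀ (+ r) (2 ℕ.* m ℕ.+ 1) ≡ wseq (+ t) (+ c) z₁ (+ r) (2 ℕ.* n ℕ.+ 1) →
    ∃[ j ] + (16 ℕ.* ((a ℕ.* gap κ m n) ℕ.* (a ℕ.* gap κ m n)))
             - + (4 ℕ.* ((r ℕ.* (m ∸ n)) ℕ.* (r ℕ.* (m ∸ n)))) ≡ + c * j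
  odd-squared-congruence κ a r s t c z₀ z₁ m n hs ht n≤m z₀≡±t z₁≡±s 0<z₀z₁ v≡w =
    let g≡ , g² = same-sign s t z₀≡±t z₁≡±s 0<z₀z₁
        j , lin = odd-congruence (+ a) (+ b) (+ c) (+ s) (+ t) z₀ z₁ (+ r) m n (sym hs) (sym ht) g≡
                    (vseq≡wseq⇒lucas≡lucas (+ s) (+ t) (+ c) z₀ z₁ (+ r) (+ r) (2 ℕ.* m ℕ.+ 1) (2 ℕ.* n ℕ.+ 1) v≡w)
    in _ , (begin
      + (16 ℕ.* ((a ℕ.* y) ℕ.* (a ℕ.* y))) - + (4 ℕ.* ((r ℕ.* (m ∸ n)) ℕ.* (r ℕ.* (m ∸ n))))
        ≡⟨ cong₂ _-_ (sym (trans (+k*[i*i]≡+[k*∣i∣²] 16 X) (cong (λ u → + (16 ℕ.* (u ℕ.* u))) ∣X∣≡ay)))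
                     (sym (trans (+k*[i*i]≡+[k*∣i∣²] 4 (+ r * D)) (cong (λ u → + (4 ℕ.* (u ℕ.* u))) ∣rD∣≡rd))) ⟩
      + 16 * (X * X) - + 4 * ((+ r * D) * (+ r * D))
        ≡⟨ squared-congruence (+ a) (+ b) (+ c) (+ s * z₀) (+ r) X D j (trans g² (cong₂ _*_ (sym hs) (sym ht)))
             (trans (sym (regroup (+ a) (+ b) (+ s * z₀) (+ r) (+ T₁) (+ T₂) (+ m) (+ n))) lin) ⟩
      + c * _ ∎)
    where
    open ≡-Reasoning
    b = κ ℕ.* a
    T₁ = triangular (suc m)
    T₂ = triangular (suc n)
    Y = + T₁ - + (κ ℕ.* T₂)
    y = gap κ m n
    X = + a * + T₁ - + b * + T₂
    D = + m - + n
    regroup : ∀ a b g r T₁ T₂ M N →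
      a * g * T₁ + + 2 * r * M - (b * g * T₂ + + 2 * r * N) ≡ g * (a * T₁ - b * T₂) + + 2 * (r * (M - N))
    regroup = solve-∀
    factor : ∀ A K T₁ T₂ → A * T₁ - K * A * T₂ ≡ A * (T₁ - K * T₂)
    factor = solve-∀
    X≡aY : X ≡ + a * Y
    X≡aY = begin
      + a * + T₁ - + (κ ℕ.* a) * + T₂  ≡⟨ cong (λ u → + a * + T₁ - u * + T₂) (ℤ.pos-* κ a) ⟩
      + a * + T₁ - + κ * + a * + T₂    ≡⟨ factor (+ a) (+ κ) (+ T₁) (+ T₂) ⟩
      + a * (+ T₁ - + κ * + T₂)        ≡⟨ cong (λ u → + a * (+ T₁ - u)) (ℤ.pos-* κ T₂) ⟨
      + a * Y                          ∎
    ∣X∣≡ay : ∣ X ∣ ≡ a ℕ.* y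
    ∣X∣≡ay = trans (cong ∣_∣ X≡aY) (ℤ.abs-* (+ a) Y)
    ∣rD∣≡rd : ∣ + r * D ∣ ≡ r ℕ.* (m ∸ n)
    ∣rD∣≡rd = trans (ℤ.abs-* (+ r) D) (cong (λ u → r ℕ.* ∣ u ∣) (+m-+n≡+[m∸n] n≤m))

  odd-solution-bound : ∀ κ a b r s t c → b ≡ κ ℕ.* a → 2 ℕ.≤ κ → κ ℕ.≤ 6 →
    κ ℕ.* a ℕ.* a ℕ.+ 4 ≡ r ℕ.* r → 4 ℕ.≤ a →
    c ℤ.≤ + ((a ℕ.* b ℕ.+ 3) ℕ.* (a ℕ.* b ℕ.+ 3) ℕ.* (a ℕ.+ b ℕ.+ 2 ℕ.* r)) →
    + a * c + + 4 ≡ + s * + s → + b * c + + 4 ≡ + t * + t →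
    OddSolutionBound (+ b) c (+ s) (+ t) (+ r)
  odd-solution-bound κ a b r s t -[1+ c ] _ _ _ _ _ _ _ _ _ _ m _ _ _ _ _ _ _ _ _ =
    subst (-[1+ c ] ℤ.<_) (sym (+256[Mb]² b m)) ℤ.-<+
  odd-solution-bound κ a .(κ ℕ.* a) r s t (+ c) refl κ≥2 κ≤6 hr a≥4 c≤c₃ hs ht
                     z₀ z₁ m n z₀≡±t z₁≡±s 0<z₀z₁ _ n<m _ _ v≡w =
    ℤ.≰⇒> λ h → no-small-odd-solution a κ r c m n (gap κ m n) κ≥2 κ≤6 hr a≥4 n<m
                  (gap≤κ*m*m κ m n κ≥1 (ℕ.<⇒≤ n<m)) (ℤ.drop‿+≤+ c≤c₃)
                  (odd-squared-congruence κ a r s t c z₀ z₁ m n {{c≢0 (ℕ-bound h)}} hs ht (ℕ.<⇒≤ n<m)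
                     z₀≡±t z₁≡±s 0<z₀z₁ v≡w)
                  (ℕ-bound h)
    where
    b = κ ℕ.* a
    κ≥1 : 1 ℕ.≤ κ
    κ≥1 = ℕ.≤-trans (ℕ.≤ᵇ⇒≤ 1 2 _) κ≥2
    ℕ-bound : + 256 * (+ (m ℕ.* m) * + b) * (+ (m ℕ.* m) * + b) ℤ.≤ + c →
              256 ℕ.* (m ℕ.* m ℕ.* b) ℕ.* (m ℕ.* m ℕ.* b) ℕ.≤ c
    ℕ-bound h = ℤ.drop‿+≤+ (subst (ℤ._≤ + c) (+256[Mb]² b m) h)
    c≢0 : 256 ℕ.* (m ℕ.* m ℕ.* b) ℕ.* (m ℕ.* m ℕ.* b) ℕ.≤ c → NonZero c
    c≢0 h = ℕ.>-nonZero (ℕ.<-≤-trans (ℕ.*-mono-≤ (ℕ.*-mono-≤ (ℕ.≤ᵇ⇒≤ 1 256 _) Mb≥1) Mb≥1) h)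
      where
      m≥1 = ℕ.≤-trans (ℕ.s≤s ℕ.z≤n) n<m
      Mb≥1 : 1 ℕ.≤ m ℕ.* m ℕ.* b
      Mb≥1 = ℕ.*-mono-≤ (ℕ.*-mono-≤ m≥1 m≥1) (ℕ.*-mono-≤ κ≥1 (ℕ.≤-trans (ℕ.≤ᵇ⇒≤ 1 4 _) a≥4))

  c₃≤ : ∀ a b r c → c ≡ c3plus (+ a) (+ b) (+ r) ⊎ c ≡ c3minus (+ a) (+ b) (+ r) →
    c ℤ.≤ + ((a ℕ.* b ℕ.+ 3) ℕ.* (a ℕ.* b ℕ.+ 3) ℕ.* (a ℕ.+ b ℕ.+ 2 ℕ.* r))
  c₃≤ a b r c c≡c₃ = subst (c ℤ.≤_) (sym +P) (bound c≡c₃)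
    where
    AB3 = + a * + b + + 3
    P = AB3 * AB3 * (+ a + + b + + 2 * + r)
    q = 4 ℕ.* r ℕ.* (a ℕ.* b ℕ.+ 3)
    +ab3 : + (a ℕ.* b ℕ.+ 3) ≡ AB3
    +ab3 = cong (_+ + 3) (ℤ.pos-* a b)
    +P : + ((a ℕ.* b ℕ.+ 3) ℕ.* (a ℕ.* b ℕ.+ 3) ℕ.* (a ℕ.+ b ℕ.+ 2 ℕ.* r)) ≡ P
    +P = trans (ℤ.pos-* ((a ℕ.* b ℕ.+ 3) ℕ.* (a ℕ.* b ℕ.+ 3)) (a ℕ.+ b ℕ.+ 2 ℕ.* r))
               (cong₂ _*_ (trans (ℤ.pos-* (a ℕ.* b ℕ.+ 3) (a ℕ.* b ℕ.+ 3)) (cong₂ _*_ +ab3 +ab3))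
                                                          (cong (λ u → + a + + b + u) (ℤ.pos-* 2 r)))
    +q : + q ≡ + 4 * + r * AB3
    +q = trans (ℤ.pos-* (4 ℕ.* r) (a ℕ.* b ℕ.+ 3)) (cong₂ _*_ (ℤ.pos-* 4 r) +ab3)
    +q′ : + (q ℕ.* (a ℕ.* b ℕ.+ 2)) ≡ + 4 * + r * AB3 * (+ a * + b + + 2)
    +q′ = trans (ℤ.pos-* q (a ℕ.* b ℕ.+ 2)) (cong₂ _*_ +q (cong (_+ + 2) (ℤ.pos-* a b)))
    plus-form : ∀ A B R → (A * A * B * B + + 6 * A * B + + 9) * (A + B + + 2 * R) - + 4 * R * (A * B + + 3)
                          ≡ (A * B + + 3) * (A * B + + 3) * (A + B + + 2 * R) - + 4 * R * (A * B + + 3)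
    plus-form = solve-∀
    minus-form : ∀ A B R → (A * A * B * B + + 6 * A * B + + 9) * (A + B - + 2 * R) + + 4 * R * (A * B + + 3)
                           ≡ (A * B + + 3) * (A * B + + 3) * (A + B + + 2 * R) - + 4 * R * (A * B + + 3) * (A * B + + 2)
    minus-form = solve-∀
    open ℤ.≤-Reasoning
    bound : c ≡ c3plus (+ a) (+ b) (+ r) ⊎ c ≡ c3minus (+ a) (+ b) (+ r) → c ℤ.≤ P
    bound (inj₁ refl) = begin
      c3plus (+ a) (+ b) (+ r)   ≡⟨ plus-form (+ a) (+ b) (+ r) ⟩
      P - + 4 * + r * AB3        ≡⟨ cong (λ u → P - u) +q ⟨
      P - + q                    ≤⟨ ℤ.i-j≤i P (+ q) ⟩
      P                          ∎
    bound (inj₂ refl) = begin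
      c3minus (+ a) (+ b) (+ r)                  ≡⟨ minus-form (+ a) (+ b) (+ r) ⟩
      P - + 4 * + r * AB3 * (+ a * + b + + 2)    ≡⟨ cong (λ u → P - u) +q′ ⟨
      P - + (q ℕ.* (a ℕ.* b ℕ.+ 2))               ≤⟨ ℤ.i-j≤i P (+ (q ℕ.* (a ℕ.* b ℕ.+ 2))) ⟩
      P                                          ∎

open EvenIndexBound using (EvenSolutionBound; even-solution-bound)
open OddIndexBound using (OddSolutionBound; odd-solution-bound; c₃≤)

small-coefficient : ∀ {k} → k ≡ + 2 ⊎ k ≡ + 3 ⊎ k ≡ + 6 → ∃[ κ ] k ≡ + κ × 2 ℕ.≤ κ × κ ℕ.≤ 6
small-coefficient (inj₁ refl) = 2 , refl , ℕ.≤ᵇ⇒≤ 2 2 _ , ℕ.≤ᵇ⇒≤ 2 6 _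
small-coefficient (inj₂ (inj₁ refl)) = 3 , refl , ℕ.≤ᵇ⇒≤ 2 3 _ , ℕ.≤ᵇ⇒≤ 3 6 _
small-coefficient (inj₂ (inj₂ refl)) = 6 , refl , ℕ.≤ᵇ⇒≤ 2 6 _ , ℕ.≤ᵇ⇒≤ 6 6 _

lemma4p5 : (k a r b c s t : ℤ) →
    (k ≡ + 2 ⊎ k ≡ + 3 ⊎ k ≡ + 6) →
    ℤ.+ 0 ℤ.< a → ℤ.+ 0 ℤ.< r → k ℤ.* a ℤ.* a ℤ.+ + 4 ≡ r ℤ.* r →
    b ≡ k ℤ.* a → + (100000) ℤ.< b →
    (c ≡ c3plus a b r ⊎ c ≡ c3minus a b r) →
    + 0 ℤ.< s → + 0 ℤ.< t →
    a ℤ.* c ℤ.+ + 4 ≡ s ℤ.* s → b ℤ.* c ℤ.+ + 4 ≡ t ℤ.* t →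
    -- (i)  conclusion m > 0.495 b^(-1/2) c^(1/2), squared and cleared of denominators
    ((z₀ : ℤ) (m n : ℕ) → (z₀ ≡ + 2 ⊎ z₀ ≡ - + 2) →
      2 ℕ.< n → n ℕ.< m → m ℕ.< 2 ℕ.* n → 1 ℕ.< n →
      vseq s c z₀ (+ 2) (2 ℕ.* m) ≡ wseq t c z₀ (+ 2) (2 ℕ.* n) →
      + 245025 ℤ.* c ℤ.< + 1000000 ℤ.* b ℤ.* + (m ℕ.* m))
    ×
    -- (ii) conclusion m² > 0.0625 b^(-1) c^(1/2), i.e. 256 (m² b)² > c
    ((z₀ z₁ : ℤ) (m n : ℕ) → (z₀ ≡ t ⊎ z₀ ≡ - t) → (z₁ ≡ s ⊎ z₁ ≡ - s) →
      + 0 ℤ.< z₀ ℤ.* z₁ →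
      2 ℕ.< n → n ℕ.< m → m ℕ.< 2 ℕ.* n → 1 ℕ.< n →
      vseq s c z₀ r (2 ℕ.* m ℕ.+ 1) ≡ wseq t c z₁ r (2 ℕ.* n ℕ.+ 1) →
      c ℤ.< + 256 ℤ.* (+ (m ℕ.* m) ℤ.* b) ℤ.* (+ (m ℕ.* m) ℤ.* b))
lemma4p5 k (+ a) (+ r) (+ b) c (+ s) (+ t) k∈ (ℤ.+<+ _) (ℤ.+<+ _) hr b≡ka (ℤ.+<+ b>10⁵) c≡c₃
         (ℤ.+<+ _) (ℤ.+<+ _) hs ht =
  bounds (small-coefficient k∈)
  where
  bounds : ∃[ κ ] k ≡ + κ × 2 ℕ.≤ κ × κ ℕ.≤ 6 →
           EvenSolutionBound (+ b) c (+ s) (+ t) × OddSolutionBound (+ b) c (+ s) (+ t) (+ r)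
  bounds (κ , k≡κ , κ≥2 , κ≤6) =
    even-solution-bound a b s t c a≤b b>10⁵ hs ht ,
    odd-solution-bound κ a b r s t c b≡κa κ≥2 κ≤6 hr′ a≥4 (c₃≤ a b r c c≡c₃) hs ht
    where
    b≡κa : b ≡ κ ℕ.* a
    b≡κa = ℤ.+-injective (trans b≡ka (trans (cong (ℤ._* + a) k≡κ) (sym (ℤ.pos-* κ a))))
    a≤b : a ℕ.≤ b
    a≤b = subst (a ℕ.≤_) (sym b≡κa) (ℕ.m≤n*m a κ {{ℕ.>-nonZero (ℕ.≤-trans (ℕ.≤ᵇ⇒≤ 1 2 _) κ≥2)}})
    a≥4 : 4 ℕ.≤ a
    a≥4 = ℕ.≮⇒≥ λ a<4 → ℕ.<⇒≱ b>10⁵ (ℕ.≤-trans (ℕ.≤-reflexive b≡κa)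
            (ℕ.≤-trans (ℕ.*-mono-≤ κ≤6 (ℕ.s≤s⁻¹ a<4)) (ℕ.≤ᵇ⇒≤ 18 100000 _)))
    hr′ : κ ℕ.* a ℕ.* a ℕ.+ 4 ≡ r ℕ.* r
    hr′ = ℤ.+-injective (begin
      + (κ ℕ.* a ℕ.* a) ℤ.+ + 4
        ≡⟨ cong (ℤ._+ + 4) (trans (ℤ.pos-* (κ ℕ.* a) a) (cong (ℤ._* + a) (ℤ.pos-* κ a))) ⟩
      + κ ℤ.* + a ℤ.* + a ℤ.+ + 4 ≡⟨ cong (λ k → k ℤ.* + a ℤ.* + a ℤ.+ + 4) k≡κ ⟨
      k ℤ.* + a ℤ.* + a ℤ.+ + 4   ≡⟨ hr ⟩
      + r ℤ.* + r                 ≡⟨ ℤ.pos-* r r ⟨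
      + (r ℕ.* r)                 ∎)
      where open ≡-Reasoning
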